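{- For any positive integers $n,r$ with $r\le n^2$, there exists an $n$-vertex directed graph $G$ together with a set $\mathcal{P}$ of $r$ vertex pairs such that any 2-fault-tolerant reachability oracle of $G$ for $\mathcal{P}$ must have size $\Omega(n\sqrt{|\mathcal{P}|})$ bits.
   Context: For a directed graph $G=(V,E)$ and $\mathcal{P}\subseteq V\times V$, a $k$-fault-tolerant reachability oracle of $G$ for $\mathcal{P}$ is a data structure that, given any pair $(s,t)\in\mathcal{P}$ and any set $F\subseteq E$ of at most $k$ edges, decides whether $t$ is reachable from $s$ in the graph $G\setminus F$ obtained by deleting the edges of $F$. -}

module Defs where

open import Data.Nat using (ℕ; _≤_)
open import Data.Bool using (Bool; true; false)
open import Data.Fin using (Fin)
open import Data.Product using (_×_; _,_; proj₁; proj₂)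
open import Data.List using (List; length)
open import Data.List.Membership.Propositional using (_∈_)
open import Data.List.Relation.Unary.All using (All)
open import Relation.Nullary using (¬_)
open import Relation.Binary.PropositionalEquality using (_≡_)
open import Relation.Binary.Construct.Closure.ReflexiveTransitive using (Star)
open import Function.Bundles using (_⇔_)

Graph : ℕ → Set
Graph n = Fin n → Fin n → Bool

VPair : ℕ → Set
VPair n = Fin n × Fin n

Loopless : ∀ {n} → Graph n → Set
Loopless {n} G = (v : Fin n) → G v v ≡ false

_∖_ : ∀ {n} → Graph n → List (VPair n) → Fin n → Fin n → Set
(G ∖ F) u v = (G u v ≡ true) × ¬ ((u , v) ∈ F)

Reachable : ∀ {n} → Graph n → List (VPair n) → Fin n → Fin n → Set
Reachable G F s t = Star (G ∖ F) s t

FaultSet : ∀ {n} → Graph n → ℕ → List (VPair n) → Set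
FaultSet G k F = (length F ≤ k) × All (λ e → G (proj₁ e) (proj₂ e) ≡ true) F

-- An oracle scheme on n-vertex graphs: each graph G is stored as a bit
-- string  enc G  (its size in bits is  length (enc G)), and queries are
-- answered by a fixed query algorithm reading only the stored bits.
record Oracle (n : ℕ) : Set where
  field
    enc   : Graph n → List Bool
    query : List Bool → Fin n → Fin n → List (VPair n) → Bool
open Oracle public

IsFTReachOracle : ∀ {n} → ℕ → List (VPair n) → Oracle n → Set
IsFTReachOracle {n} k P O =
  (G : Graph n) → Loopless G →
  (s t : Fin n) → (s , t) ∈ P →
  (F : List (VPair n)) → FaultSet G k F →
  (query O (enc O G) s t F ≡ true) ⇔ Reachable G F s t

-- Put k ≈ √r / 8 source paths and k target paths, each with b + 1 ≈ n / 2k vertices numbered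
-- 0, …, b, into the n vertices, and let a bit matrix B ∈ {0,1}^(k×k×b) add an edge from vertex q of
-- source path i to vertex q + 1 of target path j whenever B i j q is set.  After deleting the edge
-- q → q + 1 on source path i and on target path j, vertex b of target path j is reachable from
-- vertex 0 of source path i exactly when B i j q is set: every other bit edge leaving vertices
-- 0, …, q of source path i lands on target path j at or before vertex q.  A 2-fault-tolerant oracle
-- for these k² pairs therefore recovers B from its stored bits, so for one of the 2^(k²b) graphs
-- it stores at least k²b − 1 bits, and k²b is of order n √r.

module Submission where

open import Defs
open import Data.Bool using (Bool; true; false)
open import Data.Bool.Properties using () renaming (_≟_ to _≟ᴮ_)
open import Data.Empty using (⊥-elim)
open import Data.Fin as Fin using (Fin; zero; suc; toℕ; fromℕ; inject₁; inject≤; combine; remQuot)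
open import Data.Fin.Properties
  using (_≟_; 2↔Bool; *↔×; any?; injective⇒≤; remQuot-combine; combine-remQuot; combine-injective;
         combine-surjective; toℕ-inject₁; toℕ-fromℕ; toℕ<n; inject≤-injective; ≤fromℕ; ≤∧≢⇒<; <-irrefl)
open import Data.List as List
  using (List; []; _∷_; length; _++_; map; filter; take; allFin; cartesianProduct; cartesianProductWith)
open import Data.List.Properties using (length-++; length-take; length-tabulate)
open import Data.List.Membership.Propositional using (_∈_; _∉_)
open import Data.List.Membership.Propositional.Properties
  using (∈-∃++; ∈-++⁻; ∈-++⁺ˡ; ∈-++⁺ʳ; ∈-map⁺; ∈-map⁻; ∈-filter⁺; ∈-filter⁻; ∈-tabulate⁺; ∈-allFin;
         ∈-cartesianProductWith⁺; ∈-cartesianProduct⁺)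
open import Data.List.Relation.Binary.Subset.Propositional using (_⊆_)
open import Data.List.Relation.Unary.All as All using ([]; _∷_)
open import Data.List.Relation.Unary.AllPairs using (_∷_)
open import Data.List.Relation.Unary.Any using (here; there)
open import Data.List.Relation.Unary.Unique.Propositional using (Unique)
import Data.List.Relation.Unary.Unique.Propositional.Properties as Unique
open import Data.Nat
  using (ℕ; zero; suc; _+_; _*_; _^_; _/_; _%_; _⊓_; _≤_; _<_; _≤?_; _<?_; z≤n; s≤s; s≤s⁻¹; NonZero)
open import Data.Nat.DivMod using (m/n*n≤m; m≡m%n+[m/n]*n; m%n<n)
open import Data.Nat.Properties
  using (≤-refl; ≤-reflexive; ≤-trans; ≤-antisym; <⇒≤; <⇒≢; <⇒≱; ≮⇒≥; ≰⇒>; <-≤-trans; 1+n≢n; n<1+n;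
         n≤1+n; m≤n⇒m≤1+n; m≤m+n; +-suc; +-monoˡ-≤; +-monoˡ-<; *-comm; *-assoc; *-mono-≤; *-monoˡ-≤; *-monoʳ-≤;
         *-mono-<; m≤m*n; ^-monoʳ-<; m≤n⇒m⊓n≡m; module ≤-Reasoning)
open import Data.Nat.Tactic.RingSolver using (solve-∀)
open import Data.Product using (∃; ∃₂; Σ; _×_; _,_; proj₁; proj₂)
open import Data.Product.Properties using (≡-dec)
open import Data.Sum using (_⊎_; inj₁; inj₂)
open import Data.Vec as Vec using (Vec; []; _∷_; replicate; head; tail; lookup)
open import Data.Vec.Properties using (tabulate∘lookup; tabulate-cong)
open import Function using (_∘_; id; _↔_; _↣_; _⇔_; Injective; mk↔ₛ′; mk↣; mk⇔)
open import Function.Bundles using (Equivalence; Inverse; Injection)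
open import Function.Construct.Composition using (_↣-∘_; _⇔-∘_)
open import Function.Construct.Symmetry using (⇔-sym)
open import Function.Properties.Inverse using (↔⇒↣; ↔-sym)
open import Relation.Binary.Construct.Closure.ReflexiveTransitive using (Star; ε; _◅_; _◅◅_; fold)
open import Relation.Binary.Definitions using (DecidableEquality)
open import Relation.Binary.PropositionalEquality
  using (_≡_; _≢_; refl; sym; trans; cong; cong₂; subst; module ≡-Reasoning)
open import Relation.Nullary using (¬_; Dec; yes; no; ¬?)
open import Relation.Nullary.Decidable using (isYes; map′)
open import Relation.Unary using (Decidable)

Vec↔Fin^ : ∀ {a} {A : Set} → Fin a ↔ A → ∀ m → Vec A m ↔ Fin (a ^ m)
Vec↔Fin^ {a} {A} A↔ m = mk↔ₛ′ (toFin m) (fromFin m) (toFin∘fromFin m) (fromFin∘toFin m)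
  where
  open Inverse A↔ using (to; from; strictlyInverseˡ; strictlyInverseʳ)

  toFin : ∀ m → Vec A m → Fin (a ^ m)
  toFin zero    []       = zero
  toFin (suc m) (x ∷ xs) = combine (from x) (toFin m xs)

  fromFin : ∀ m → Fin (a ^ m) → Vec A m
  fromFin zero    _ = []
  fromFin (suc m) i = to (proj₁ (remQuot {a} (a ^ m) i)) ∷ fromFin m (proj₂ (remQuot {a} (a ^ m) i))

  fromFin∘toFin : ∀ m xs → fromFin m (toFin m xs) ≡ xs
  fromFin∘toFin zero    []       = refl
  fromFin∘toFin (suc m) (x ∷ xs) =
    trans (cong (λ (c , j) → to c ∷ fromFin m j) (remQuot-combine {a} {a ^ m} (from x) (toFin m xs)))
          (cong₂ _∷_ (strictlyInverseˡ x) (fromFin∘toFin m xs))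

  toFin∘fromFin : ∀ m i → toFin m (fromFin m i) ≡ i
  toFin∘fromFin zero    zero = refl
  toFin∘fromFin (suc m) i =
    trans (cong₂ combine (strictlyInverseʳ c) (toFin∘fromFin m j)) (combine-remQuot {a} (a ^ m) i)
    where
    c : Fin a
    c = proj₁ (remQuot {a} (a ^ m) i)
    j : Fin (a ^ m)
    j = proj₂ (remQuot {a} (a ^ m) i)

Bits↔Fin : ∀ m → Vec Bool m ↔ Fin (2 ^ m)
Bits↔Fin = Vec↔Fin^ 2↔Bool

no-injection-Bits-suc : ∀ m (f : Vec Bool (suc m) → Vec Bool m) → ¬ Injective _≡_ _≡_ f
no-injection-Bits-suc m f f-inj = <⇒≱ 2^m<2^[1+m] (injective⇒≤ (Injection.injective g))
  where
  g : Fin (2 ^ suc m) ↣ Fin (2 ^ m)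
  g = ↔⇒↣ (Bits↔Fin m) ↣-∘ (mk↣ f-inj ↣-∘ ↔⇒↣ (↔-sym (Bits↔Fin (suc m))))
  2^m<2^[1+m] : 2 ^ m < 2 ^ suc m
  2^m<2^[1+m] = ^-monoʳ-< 2 (s≤s (s≤s z≤n)) (n<1+n m)

∃?-↔Fin : ∀ {a} {A : Set} {P : A → Set} → Fin a ↔ A → Decidable P → Dec (∃ P)
∃?-↔Fin {P = P} A↔ P? =
  map′ (λ (i , p) → to i , p) (λ (x , p) → from x , subst P (sym (strictlyInverseˡ x)) p) (any? (P? ∘ to))
  where open Inverse A↔ using (to; from; strictlyInverseˡ)

-- The `true` marks where the list ends, which makes padding injective.
pad : ∀ {L} (xs : List Bool) → length xs < L → Vec Bool L
pad {suc L} []       _         = true ∷ replicate L false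
pad {suc L} (x ∷ xs) (s≤s len) = x ∷ pad xs len

pad≢replicate-false : ∀ {L} (xs : List Bool) (len : length xs < L) → pad xs len ≢ replicate L false
pad≢replicate-false {suc L} []           _         ()
pad≢replicate-false {suc L} (true ∷ xs)  (s≤s len) ()
pad≢replicate-false {suc L} (false ∷ xs) (s≤s len) eq = pad≢replicate-false xs len (cong tail eq)

pad-injective : ∀ {L} (xs ys : List Bool) (p : length xs < L) (q : length ys < L) →
                pad xs p ≡ pad ys q → xs ≡ ys
pad-injective {suc L} []       []       _       _       _  = refl
pad-injective {suc L} []       (y ∷ ys) _       (s≤s q) eq with refl ← cong head eq =
  ⊥-elim (pad≢replicate-false ys q (sym (cong tail eq)))
pad-injective {suc L} (x ∷ xs) []       (s≤s p) _       eq with refl ← cong head eq =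
  ⊥-elim (pad≢replicate-false xs p (cong tail eq))
pad-injective {suc L} (x ∷ xs) (y ∷ ys) (s≤s p) (s≤s q) eq =
  cong₂ _∷_ (cong head eq) (pad-injective xs ys p q (cong tail eq))

injective-Bits⇒long-image : ∀ m (f : Vec Bool m → List Bool) → Injective _≡_ _≡_ f →
                            ∃ λ v → m ≤ suc (length (f v))
injective-Bits⇒long-image zero    f _     = [] , z≤n
injective-Bits⇒long-image (suc m) f f-inj
  with ∃?-↔Fin (↔-sym (Bits↔Fin (suc m))) (λ v → m ≤? length (f v))
... | yes (v , m≤∣fv∣) = v , s≤s m≤∣fv∣
... | no  ∄long        =
  ⊥-elim (no-injection-Bits-suc m (λ v → pad (f v) (short v)) (f-inj ∘ pad-injective _ _ _ _))
  where
  short : ∀ v → length (f v) < m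
  short v = ≰⇒> (∄long ∘ (v ,_))

integer-sqrt : ∀ r → ∃ λ q → q * q ≤ r × r < suc q * suc q
integer-sqrt zero = 0 , z≤n , s≤s z≤n
integer-sqrt (suc r) with integer-sqrt r
... | q , q²≤r , r<[1+q]² with suc r <? suc q * suc q
...   | yes 1+r<[1+q]² = q , m≤n⇒m≤1+n q²≤r , 1+r<[1+q]²
...   | no  1+r≮[1+q]² = suc q , ≤-reflexive (sym 1+r≡[1+q]²) ,
                         subst (_< suc (suc q) * suc (suc q)) (sym 1+r≡[1+q]²)
                               (*-mono-< (n<1+n (suc q)) (n<1+n (suc q)))
  where
  1+r≡[1+q]² : suc r ≡ suc q * suc q
  1+r≡[1+q]² = ≤-antisym r<[1+q]² (≮⇒≥ 1+r≮[1+q]²)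

/-bounds : ∀ m d .{{_ : NonZero d}} → m / d * d ≤ m × m < suc (m / d) * d
/-bounds m d = m/n*n≤m m d , m<[1+m/d]*d
  where
  open ≤-Reasoning
  m<[1+m/d]*d : m < suc (m / d) * d
  m<[1+m/d]*d = begin-strict
    m                 ≡⟨ m≡m%n+[m/n]*n m d ⟩
    m % d + m / d * d <⟨ +-monoˡ-< (m / d * d) (m%n<n m d) ⟩
    d + m / d * d     ∎

grid-side : ∀ n r → 8 ≤ n → 1 ≤ r → r ≤ n * n →
            ∃ λ k → 1 ≤ k × k * k ≤ r × r ≤ 256 * (k * k) × 8 * k ≤ n
grid-side n r 8≤n 1≤r r≤n² with integer-sqrt r
... | q , q²≤r , r<[1+q]² with q / 8 | /-bounds q 8
...   | zero  | _           , q<8          =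
  1 , ≤-refl , 1≤r , ≤-trans (<⇒≤ (<-≤-trans r<[1+q]² (*-mono-≤ q<8 q<8))) (m≤m+n 64 192) , 8≤n
...   | suc a | [1+a]*8≤q , q<[2+a]*8 = suc a , s≤s z≤n , ≤-trans (*-mono-≤ k≤q k≤q) q²≤r , r≤256k² , 8k≤n
  where
  q≤n : q ≤ n
  q≤n = ≮⇒≥ λ n<q → <⇒≱ (*-mono-< n<q n<q) (≤-trans q²≤r r≤n²)
  k≤q : suc a ≤ q
  k≤q = ≤-trans (m≤m*n (suc a) 8) [1+a]*8≤q
  1+q≤16k : suc q ≤ 16 * suc a
  1+q≤16k = ≤-trans q<[2+a]*8 (subst (suc (suc a) * 8 ≤_) (sym (16[1+a]≡ a)) (m≤m+n _ (a * 8)))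
    where
    16[1+a]≡ : ∀ a → 16 * suc a ≡ suc (suc a) * 8 + a * 8
    16[1+a]≡ = solve-∀
  r≤256k² : r ≤ 256 * (suc a * suc a)
  r≤256k² = <⇒≤ (<-≤-trans r<[1+q]² (≤-trans (*-mono-≤ 1+q≤16k 1+q≤16k) (≤-reflexive (square-16* (suc a)))))
    where
    square-16* : ∀ k → 16 * k * (16 * k) ≡ 256 * (k * k)
    square-16* = solve-∀
  8k≤n : 8 * suc a ≤ n
  8k≤n = ≤-trans (≤-reflexive (*-comm 8 (suc a))) (≤-trans [1+a]*8≤q q≤n)

path-length : ∀ n k → 1 ≤ k → 8 * k ≤ n → ∃ λ b → 3 ≤ b × 2 * (k * suc b) ≤ n × n ≤ 4 * (k * b)
path-length n k@(suc _) _ 8k≤n with n / (2 * k) | /-bounds n (2 * k)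
... | c | c*2k≤n , n<[1+c]*2k with 4 ≤? c
...   | no  c≱4 = ⊥-elim (<⇒≱ n<[1+c]*2k [1+c]*2k≤n)
  where
  open ≤-Reasoning
  [1+c]*2k≤n : suc c * (2 * k) ≤ n
  [1+c]*2k≤n = begin
    suc c * (2 * k) ≤⟨ *-monoˡ-≤ (2 * k) (≰⇒> c≱4) ⟩
    4 * (2 * k)     ≡⟨ sym (*-assoc 4 2 k) ⟩
    8 * k           ≤⟨ 8k≤n ⟩
    n               ∎
...   | yes (s≤s {n = b} 3≤b) = b , 3≤b , subst (_≤ n) (2[k[1+b]]≡ k b) c*2k≤n , n≤4kb
  where
  open ≤-Reasoning
  2[k[1+b]]≡ : ∀ k b → suc b * (2 * k) ≡ 2 * (k * suc b)
  2[k[1+b]]≡ = solve-∀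
  [b+b][2k]≡ : ∀ k b → (b + b) * (2 * k) ≡ 4 * (k * b)
  [b+b][2k]≡ = solve-∀
  n≤4kb : n ≤ 4 * (k * b)
  n≤4kb = begin
    n                     ≤⟨ <⇒≤ n<[1+c]*2k ⟩
    suc (suc b) * (2 * k) ≤⟨ *-monoˡ-≤ (2 * k) (+-monoˡ-≤ b (≤-trans (s≤s (s≤s z≤n)) 3≤b)) ⟩
    (b + b) * (2 * k)     ≡⟨ [b+b][2k]≡ k b ⟩
    4 * (k * b)           ∎

2≤m≤1+n⇒m≤n+n : ∀ {m n} → 2 ≤ m → m ≤ suc n → m ≤ n + n
2≤m≤1+n⇒m≤n+n {n = n} 2≤m m≤1+n = ≤-trans m≤1+n (+-monoˡ-≤ n (s≤s⁻¹ (≤-trans 2≤m m≤1+n)))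

size-bound : ∀ n r k b ℓ → 1 ≤ k → 2 ≤ b → r ≤ 256 * (k * k) → n ≤ 4 * (k * b) →
             k * (k * b) ≤ suc ℓ → n * n * r ≤ (128 * ℓ) ^ 2
size-bound n r k b ℓ 1≤k 2≤b r≤256k² n≤4kb k²b≤1+ℓ = begin
  n * n * r                                     ≤⟨ *-mono-≤ (*-mono-≤ n≤4kb n≤4kb) r≤256k² ⟩
  4 * (k * b) * (4 * (k * b)) * (256 * (k * k)) ≡⟨ regroup k b ⟩
  4096 * (k * (k * b)) * (k * (k * b))          ≤⟨ *-mono-≤ (*-monoʳ-≤ 4096 k²b≤2ℓ) k²b≤2ℓ ⟩
  4096 * (ℓ + ℓ) * (ℓ + ℓ)                      ≡⟨ square-128* ℓ ⟩
  (128 * ℓ) ^ 2                                 ∎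
  where
  open ≤-Reasoning
  k²b≤2ℓ : k * (k * b) ≤ ℓ + ℓ
  k²b≤2ℓ = 2≤m≤1+n⇒m≤n+n (*-mono-≤ 1≤k (*-mono-≤ 1≤k 2≤b)) k²b≤1+ℓ
  regroup : ∀ k b → 4 * (k * b) * (4 * (k * b)) * (256 * (k * k)) ≡ 4096 * (k * (k * b)) * (k * (k * b))
  regroup = solve-∀
  square-128* : ∀ ℓ → 4096 * (ℓ + ℓ) * (ℓ + ℓ) ≡ 128 * ℓ * (128 * ℓ * 1)
  square-128* = solve-∀

parameters : ∀ n r → 8 ≤ n → 1 ≤ r → r ≤ n * n →
  ∃₂ λ k b → 1 ≤ k × 2 ≤ b × k * k ≤ r × r ≤ 256 * (k * k) × 2 * (k * suc b) ≤ n × n ≤ 4 * (k * b)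
parameters n r 8≤n 1≤r r≤n²
  with k , 1≤k , k²≤r , r≤256k² , 8k≤n ← grid-side n r 8≤n 1≤r r≤n²
  with b , 3≤b , fits , n≤4kb ← path-length n k 1≤k 8k≤n
  = k , b , 1≤k , ≤-trans (n≤1+n 2) 3≤b , k²≤r , r≤256k² , fits , n≤4kb

module _ {A : Set} where

  Unique-⊆⇒length≤ : ∀ {xs ys : List A} → Unique xs → xs ⊆ ys → length xs ≤ length ys
  Unique-⊆⇒length≤ {[]}     _           _    = z≤n
  Unique-⊆⇒length≤ {x ∷ xs} (x∉xs ∷ xs!) x∷xs⊆ys with us , vs , refl ← ∈-∃++ (x∷xs⊆ys (here refl)) =
    subst (suc (length xs) ≤_) (sym (length-++ us)) (≤-trans (s≤s ih) (≤-reflexive length-us++vs))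
    where
    xs⊆us++vs : xs ⊆ us ++ vs
    xs⊆us++vs {z} z∈xs with ∈-++⁻ us (x∷xs⊆ys (there z∈xs))
    ... | inj₁ z∈us          = ∈-++⁺ˡ z∈us
    ... | inj₂ (here refl)   = ⊥-elim (All.lookup x∉xs z∈xs refl)
    ... | inj₂ (there z∈vs)  = ∈-++⁺ʳ us z∈vs
    ih : length xs ≤ length (us ++ vs)
    ih = Unique-⊆⇒length≤ xs! xs⊆us++vs
    length-us++vs : suc (length (us ++ vs)) ≡ length us + suc (length vs)
    length-us++vs = trans (cong suc (length-++ us)) (sym (+-suc (length us) (length vs)))

  length-filter+filter¬ : ∀ {P : A → Set} (P? : Decidable P) xs →
                          length (filter P? xs) + length (filter (¬? ∘ P?) xs) ≡ length xs
  length-filter+filter¬ P? [] = refl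
  length-filter+filter¬ P? (x ∷ xs) with P? x
  ... | yes _ = cong suc (length-filter+filter¬ P? xs)
  ... | no  _ = trans (+-suc _ _) (cong suc (length-filter+filter¬ P? xs))

  ∈-take-++ : ∀ {x} (xs ys : List A) r → x ∈ xs → length xs ≤ r → x ∈ take r (xs ++ ys)
  ∈-take-++ (_ ∷ xs) ys (suc r) (here x≡)  _           = here x≡
  ∈-take-++ (_ ∷ xs) ys (suc r) (there x∈) (s≤s len≤r) = there (∈-take-++ xs ys r x∈ len≤r)

module _ {A : Set} (_≟ᴬ_ : DecidableEquality A) {m} (enum : Fin m ↔ A) where
  open import Data.List.Membership.DecPropositional _≟ᴬ_ using (_∈?_)
  open Inverse enum using (to; from; strictlyInverseˡ)

  extend-to-length : ∀ r (g : List A) → length g ≤ r → r ≤ m →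
                     ∃ λ P → length P ≡ r × Unique P × g ⊆ P
  extend-to-length r g g≤r r≤m = take r (inG ++ outG) , length-P , Unique.take⁺ r Unique-inG++outG , g⊆P
    where
    all : List A
    all = List.tabulate to
    Unique-all : Unique all
    Unique-all = Unique.tabulate⁺ (Injection.injective (↔⇒↣ enum))
    inG outG : List A
    inG  = filter (_∈? g) all
    outG = filter (¬? ∘ (_∈? g)) all
    length-P : length (take r (inG ++ outG)) ≡ r
    length-P = trans (length-take r (inG ++ outG)) (trans (cong (r ⊓_) length-all) (m≤n⇒m⊓n≡m r≤m))
      where
      length-all : length (inG ++ outG) ≡ m
      length-all = trans (length-++ inG) (trans (length-filter+filter¬ (_∈? g) all) (length-tabulate to))
    Unique-inG++outG : Unique (inG ++ outG)
    Unique-inG++outG =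
      Unique.++⁺ (Unique.filter⁺ (_∈? g) Unique-all) (Unique.filter⁺ (¬? ∘ (_∈? g)) Unique-all)
        λ (x∈inG , x∈outG) → proj₂ (∈-filter⁻ (¬? ∘ (_∈? g)) {xs = all} x∈outG)
                                   (proj₂ (∈-filter⁻ (_∈? g) {xs = all} x∈inG))
    g⊆P : g ⊆ take r (inG ++ outG)
    g⊆P {x} x∈g = ∈-take-++ inG outG r (∈-filter⁺ (_∈? g) x∈all x∈g) length-inG≤r
      where
      x∈all : x ∈ all
      x∈all = subst (_∈ all) (strictlyInverseˡ x) (∈-tabulate⁺ (from x))
      length-inG≤r : length inG ≤ r
      length-inG≤r = ≤-trans (Unique-⊆⇒length≤ (Unique.filter⁺ (_∈? g) Unique-all) inG⊆g) g≤r
        where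
        inG⊆g : inG ⊆ g
        inG⊆g = proj₂ ∘ ∈-filter⁻ (_∈? g) {xs = all}

≡true⇔⇒≡ : ∀ {x y : Bool} → x ≡ true ⇔ y ≡ true → x ≡ y
≡true⇔⇒≡ {false} {false} _ = refl
≡true⇔⇒≡ {false} {true}  x⇔y = Equivalence.from x⇔y refl
≡true⇔⇒≡ {true}  {false} x⇔y = sym (Equivalence.to x⇔y refl)
≡true⇔⇒≡ {true}  {true}  _ = refl

module _ {n : ℕ} where
  open import Data.List.Membership.DecPropositional (≡-dec (_≟_ {n}) (_≟_ {n})) using (_∈?_)

  fromEdges : List (VPair n) → Graph n
  fromEdges es u v = isYes ((u , v) ∈? es)

  fromEdges-edge : ∀ es {u v} → fromEdges es u v ≡ true ⇔ (u , v) ∈ es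
  fromEdges-edge es {u} {v} with (u , v) ∈? es
  ... | yes uv∈es = mk⇔ (λ _ → uv∈es) (λ _ → refl)
  ... | no  uv∉es = mk⇔ (λ ()) (⊥-elim ∘ uv∉es)

  fromEdges-loopless : ∀ es → (∀ u → (u , u) ∉ es) → Loopless (fromEdges es)
  fromEdges-loopless es no-loop u with (u , u) ∈? es
  ... | yes uu∈es = ⊥-elim (no-loop u uu∈es)
  ... | no  _     = refl

chain : ∀ {X : Set} {R : X → X → Set} {b} (f : Fin (suc b) → X) {p p' : Fin (suc b)} → p Fin.≤ p' →
        (∀ q → p Fin.≤ inject₁ q → inject₁ q Fin.< p' → R (f (inject₁ q)) (f (suc q))) →
        Star R (f p) (f p')
chain f {zero} {zero} _ _ = ε
chain {b = suc b} f {zero} {suc p'} _ link =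
  link zero z≤n (s≤s z≤n) ◅ chain (f ∘ suc) {zero} {p'} z≤n (λ q _ q<p' → link (suc q) z≤n (s≤s q<p'))
chain {b = suc b} f {suc p} {suc p'} (s≤s p≤p') link =
  chain (f ∘ suc) p≤p' (λ q p≤q q<p' → link (suc q) (s≤s p≤q) (s≤s q<p'))

data Side : Set where
  src tgt : Side

side-index : Side → Fin 2
side-index src = zero
side-index tgt = suc zero

side-index-injective : ∀ {s s'} → side-index s ≡ side-index s' → s ≡ s'
side-index-injective {src} {src} _ = refl
side-index-injective {tgt} {tgt} _ = refl

module Construction (n k b : ℕ) (fits : 2 * (k * suc b) ≤ n) where

  Vertex : Set
  Vertex = Side × Fin k × Fin (suc b)

  encode : Vertex → Fin n
  encode (s , c , p) = inject≤ (combine (side-index s) (combine c p)) fits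

  encode-injective : ∀ {x y} → encode x ≡ encode y → x ≡ y
  encode-injective {s , c , p} {s' , c' , p'} eq
    with s≡s' , cp≡c'p' ← combine-injective _ _ _ _ (inject≤-injective fits fits _ _ eq)
    with refl , refl ← combine-injective c p c' p' cp≡c'p'
    = cong (_, c' , p') (side-index-injective s≡s')

  data Link : Set where
    step : Side → Fin k → Fin b → Link
    bit  : Fin k → Fin k → Fin b → Link

  start end : Link → Vertex
  start (step s c q)  = s , c , inject₁ q
  start (bit c c' q)  = src , c , inject₁ q
  end   (step s c q)  = s , c , suc q
  end   (bit c c' q)  = tgt , c' , suc q

  edge : Link → VPair n
  edge d = encode (start d) , encode (end d)

  edge-injective : ∀ {d d'} → edge d ≡ edge d' → d ≡ d'
  edge-injective {d} {d'} eq = ends-injective (encode-injective (cong proj₁ eq)) (encode-injective (cong proj₂ eq))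
    where
    ends-injective : ∀ {d d'} → start d ≡ start d' → end d ≡ end d' → d ≡ d'
    ends-injective {step s c q}   {step .s .c .q} refl refl = refl
    ends-injective {bit c c' q}   {bit .c .c' .q} refl refl = refl
    ends-injective {step src _ _} {bit _ _ _}     _    ()
    ends-injective {step tgt _ _} {bit _ _ _}     ()   _
    ends-injective {bit _ _ _}    {step src _ _}  _    ()
    ends-injective {bit _ _ _}    {step tgt _ _}  ()   _

  start≢end : ∀ d → start d ≢ end d
  start≢end (step s c q) eq = 1+n≢n (sym (trans (sym (toℕ-inject₁ q)) (cong (toℕ ∘ proj₂ ∘ proj₂) eq)))
  start≢end (bit c c' q) ()

  step′ : Side → Fin k × Fin b → Link
  step′ s (c , q) = step s c q

  bit′ : Fin k → Fin k × Fin b → Link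
  bit′ c (c' , q) = bit c c' q

  links : List Link
  links = cartesianProductWith step′ (src ∷ tgt ∷ []) (cartesianProduct (allFin k) (allFin b))
       ++ cartesianProductWith bit′ (allFin k) (cartesianProduct (allFin k) (allFin b))

  ∈-links : ∀ d → d ∈ links
  ∈-links (step s c q) =
    ∈-++⁺ˡ (∈-cartesianProductWith⁺ step′ (side∈ s) (∈-cartesianProduct⁺ (∈-allFin c) (∈-allFin q)))
    where
    side∈ : ∀ s → s ∈ src ∷ tgt ∷ []
    side∈ src = here refl
    side∈ tgt = there (here refl)
  ∈-links (bit c c' q) =
    ∈-++⁺ʳ _ (∈-cartesianProductWith⁺ bit′ (∈-allFin c) (∈-cartesianProduct⁺ (∈-allFin c') (∈-allFin q)))

  BitMatrix : Set
  BitMatrix = Fin k → Fin k → Fin b → Bool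

  present : BitMatrix → Link → Bool
  present B (step _ _ _) = true
  present B (bit c c' q) = B c c' q

  graph : BitMatrix → Graph n
  graph B = fromEdges (map edge (filter (λ d → present B d ≟ᴮ true) links))

  graph-edge⁺ : ∀ B d → present B d ≡ true → graph B (encode (start d)) (encode (end d)) ≡ true
  graph-edge⁺ B d present-d = Equivalence.from (fromEdges-edge _)
    (∈-map⁺ edge (∈-filter⁺ (λ d → present B d ≟ᴮ true) (∈-links d) present-d))

  graph-edge⁻ : ∀ B {u v} → graph B u v ≡ true → ∃ λ d → present B d ≡ true × edge d ≡ (u , v)
  graph-edge⁻ B uv with d , d∈ , uv≡ ← ∈-map⁻ edge (Equivalence.to (fromEdges-edge _) uv) =
    d , proj₂ (∈-filter⁻ (λ d → present B d ≟ᴮ true) {xs = links} d∈) , sym uv≡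

  graph-loopless : ∀ B → Loopless (graph B)
  graph-loopless B = fromEdges-loopless _ λ u uu∈ →
    let d , _ , uu≡ = ∈-map⁻ edge uu∈
    in start≢end d (encode-injective (trans (sym (cong proj₁ uu≡)) (cong proj₂ uu≡)))

  cut : Fin k → Fin k → Fin b → List Link
  cut i j l = step src i l ∷ step tgt j l ∷ []

  faults : Fin k → Fin k → Fin b → List (VPair n)
  faults i j l = map edge (cut i j l)

  faults-FaultSet : ∀ B i j l → FaultSet (graph B) 2 (faults i j l)
  faults-FaultSet B i j l =
    s≤s (s≤s z≤n) , graph-edge⁺ B (step src i l) refl ∷ graph-edge⁺ B (step tgt j l) refl ∷ []

  source target : Fin k → Fin n
  source i = encode (src , i , zero)
  target j = encode (tgt , j , fromℕ b)

  module _ (B : BitMatrix) (i j : Fin k) (l : Fin b) where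

    private
      G∖F : Fin n → Fin n → Set
      G∖F = graph B ∖ faults i j l

    link-edge : ∀ d → d ∉ cut i j l → present B d ≡ true → G∖F (encode (start d)) (encode (end d))
    link-edge d d∉cut present-d = graph-edge⁺ B d present-d , λ d∈faults →
      let d' , d'∈cut , edge≡ = ∈-map⁻ edge d∈faults
      in d∉cut (subst (_∈ cut i j l) (sym (edge-injective edge≡)) d'∈cut)

    step∉cut : ∀ {s c q} → q ≢ l → step s c q ∉ cut i j l
    step∉cut q≢l (here refl)         = q≢l refl
    step∉cut q≢l (there (here refl)) = q≢l refl

    bit∉cut : ∀ {c c' q} → bit c c' q ∉ cut i j l
    bit∉cut (here ())
    bit∉cut (there (here ()))

    bit⇒reachable : B i j l ≡ true → Reachable (graph B) (faults i j l) (source i) (target j)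
    bit⇒reachable Bijl =
      chain (λ p → encode (src , i , p)) {zero} {inject₁ l} z≤n
        (λ q _ q<l → link-edge (step src i q) (step∉cut λ { refl → <-irrefl refl q<l }) refl)
      ◅◅ link-edge (bit i j l) bit∉cut Bijl
      ◅ chain (λ p → encode (tgt , j , p)) {suc l} {fromℕ b} (≤fromℕ (suc l))
        (λ q l<q _ → link-edge (step tgt j q) (step∉cut λ { refl → <⇒≢ l<q (sym (toℕ-inject₁ l)) }) refl)

    -- Without the bit edge for (i , j , l), source i reaches, on its own path and on target
    -- path j, only the vertices 0, …, l.
    Safe : Vertex → Set
    Safe (src , c , p) = c ≡ i × p Fin.≤ l
    Safe (tgt , c , p) = c ≢ j ⊎ p Fin.≤ l

    advance : ∀ {q : Fin b} → inject₁ q Fin.≤ l → q ≢ l → suc q Fin.≤ l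
    advance {q} q≤l q≢l = ≤∧≢⇒< (subst (_≤ toℕ l) (toℕ-inject₁ q) q≤l) q≢l

    safe-step : ∀ d → d ∉ cut i j l → Safe (start d) → Safe (end d) ⊎ d ≡ bit i j l
    safe-step (step src c q) d∉cut (refl , q≤l) = inj₁ (refl , advance q≤l (d∉cut ∘ here ∘ cong (step src i)))
    safe-step (step tgt c q) d∉cut safe with c ≟ j | safe
    ... | no  c≢j  | _        = inj₁ (inj₁ c≢j)
    ... | yes refl | inj₁ j≢j = ⊥-elim (j≢j refl)
    ... | yes refl | inj₂ q≤l = inj₁ (inj₂ (advance q≤l (d∉cut ∘ there ∘ here ∘ cong (step tgt j))))
    safe-step (bit c c' q) d∉cut (refl , q≤l) with c' ≟ j | q ≟ l
    ... | no  c'≢j | _        = inj₁ (inj₁ c'≢j)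
    ... | yes refl | yes refl = inj₂ refl
    ... | yes refl | no  q≢l  = inj₁ (inj₂ (advance q≤l q≢l))

    target-unsafe : ¬ Safe (tgt , j , fromℕ b)
    target-unsafe (inj₁ j≢j) = j≢j refl
    target-unsafe (inj₂ b≤l) = <⇒≱ (toℕ<n l) (subst (_≤ toℕ l) (toℕ-fromℕ b) b≤l)

    Reached : Fin n → Set
    Reached u = (∃ λ x → encode x ≡ u × Safe x) ⊎ B i j l ≡ true

    reached-step : ∀ {u v} → G∖F u v → Reached u → Reached v
    reached-step _ (inj₂ Bijl) = inj₂ Bijl
    reached-step (uv∈G , uv∉F) (inj₁ (x , refl , safe-x))
      with d , present-d , edge≡ ← graph-edge⁻ B uv∈G
      with refl ← encode-injective {start d} {x} (cong proj₁ edge≡) | refl ← cong proj₂ edge≡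
      with safe-step d (uv∉F ∘ ∈-map⁺ edge) safe-x
    ... | inj₁ safe-end = inj₁ (end d , refl , safe-end)
    ... | inj₂ refl     = inj₂ present-d

    reachable⇒bit : Reachable (graph B) (faults i j l) (source i) (target j) → B i j l ≡ true
    reachable⇒bit path
      with fold (λ u v → Reached u → Reached v) (λ e r → r ∘ reached-step e) id path
                (inj₁ ((src , i , zero) , refl , refl , z≤n))
    ... | inj₂ Bijl = Bijl
    ... | inj₁ (x , encode-x≡ , safe-x) with refl ← encode-injective {x} {tgt , j , fromℕ b} encode-x≡ =
      ⊥-elim (target-unsafe safe-x)

    reachable⇔bit : Reachable (graph B) (faults i j l) (source i) (target j) ⇔ B i j l ≡ true
    reachable⇔bit = mk⇔ reachable⇒bit bit⇒reachable

  pairs : List (VPair n)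
  pairs = List.tabulate ((λ (i , j) → source i , target j) ∘ Inverse.to *↔×)

  length-pairs : length pairs ≡ k * k
  length-pairs = length-tabulate _

  ∈-pairs : ∀ i j → (source i , target j) ∈ pairs
  ∈-pairs i j = subst (λ (i' , j') → (source i' , target j') ∈ pairs)
    (Inverse.strictlyInverseˡ *↔× (i , j)) (∈-tabulate⁺ (Inverse.from *↔× (i , j)))

  matrix : Vec Bool (k * (k * b)) → BitMatrix
  matrix v i j l = lookup v (combine i (combine j l))

  matrix-injective : ∀ {v w} → (∀ i j l → matrix v i j l ≡ matrix w i j l) → v ≡ w
  matrix-injective {v} {w} same-bits = begin
    v                       ≡⟨ tabulate∘lookup v ⟨
    Vec.tabulate (lookup v) ≡⟨ tabulate-cong same-entries ⟩
    Vec.tabulate (lookup w) ≡⟨ tabulate∘lookup w ⟩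
    w                       ∎
    where
    open ≡-Reasoning
    same-entries : ∀ x → lookup v x ≡ lookup w x
    same-entries x
      with i , y , refl ← combine-surjective {k} {k * b} x
      with j , l , refl ← combine-surjective {k} {b} y
      = same-bits i j l

  module _ (O : Oracle n) {P : List (VPair n)} (oracle : IsFTReachOracle 2 P O)
           (pairs⊆P : ∀ {p} → p ∈ pairs → p ∈ P) where

    answer : List Bool → Fin k → Fin k → Fin b → Bool
    answer code i j l = query O code (source i) (target j) (faults i j l)

    answer⇔bit : ∀ B i j l → answer (enc O (graph B)) i j l ≡ true ⇔ B i j l ≡ true
    answer⇔bit B i j l = reachable⇔bit B i j l
      ⇔-∘ oracle (graph B) (graph-loopless B) _ _ (pairs⊆P (∈-pairs i j)) _ (faults-FaultSet B i j l)

    encoding-determines-bits : ∀ B B' → enc O (graph B) ≡ enc O (graph B') → ∀ i j l → B i j l ≡ B' i j l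
    encoding-determines-bits B B' same-code i j l = ≡true⇔⇒≡ (answer⇔bit B' i j l ⇔-∘ ⇔-sym B-answers)
      where
      B-answers : answer (enc O (graph B')) i j l ≡ true ⇔ B i j l ≡ true
      B-answers = subst (λ code → answer code i j l ≡ true ⇔ B i j l ≡ true) same-code (answer⇔bit B i j l)

    long-encoding : ∃ λ B → k * (k * b) ≤ suc (length (enc O (graph B)))
    long-encoding =
      let v , long = injective-Bits⇒long-image (k * (k * b)) (enc O ∘ graph ∘ matrix)
                       (λ same-code → matrix-injective (encoding-determines-bits _ _ same-code))
      in matrix v , long

theorem1p2 : Σ ℕ λ c → Σ ℕ λ N →
    (n r : ℕ) → N ≤ n → 1 ≤ r → r ≤ n * n →
    Σ (List (VPair n)) λ P → (length P ≡ r) × Unique P ×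
      ((O : Oracle n) → IsFTReachOracle 2 P O →
        Σ (Graph n) λ G → Loopless G ×
          (n * n * r ≤ (c * length (enc O G)) ^ 2))
theorem1p2 = 128 , 8 , lower-bound
  where
  lower-bound : (n r : ℕ) → 8 ≤ n → 1 ≤ r → r ≤ n * n →
    Σ (List (VPair n)) λ P → (length P ≡ r) × Unique P ×
      ((O : Oracle n) → IsFTReachOracle 2 P O →
        Σ (Graph n) λ G → Loopless G × (n * n * r ≤ (128 * length (enc O G)) ^ 2))
  lower-bound n r 8≤n 1≤r r≤n²
    with k , b , 1≤k , 2≤b , k²≤r , r≤256k² , fits , n≤4kb ← parameters n r 8≤n 1≤r r≤n²
    with P , length-P , Unique-P , pairs⊆P ←
           extend-to-length (≡-dec _≟_ _≟_) *↔× r (Construction.pairs n k b fits)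
             (subst (_≤ r) (sym (Construction.length-pairs n k b fits)) k²≤r) r≤n²
    = P , length-P , Unique-P , λ O oracle →
        let B , long = long-encoding O oracle pairs⊆P
        in graph B , graph-loopless B ,
           size-bound n r k b (length (enc O (graph B))) 1≤k 2≤b r≤256k² n≤4kb long
    where open Construction n k b fits
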